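{- Let $r\ge 2$, $k$ and $n$ be positive integers. If $G$ is a non-bipartite graph on $n$ vertices containing no cycle of length $2k+1$ as a subgraph, with $\delta(G)\ge \frac{n}{2r+2}$, then $G$ contains an odd cycle of length at most $2(2r+1)+1$.
   Context: $\delta(G)$ denotes the minimum degree of $G$. -}

module Defs where

open import Data.Nat using (ℕ; zero; suc; _+_; _*_; _≤_)
open import Data.Fin using (Fin; toℕ)
open import Data.Bool using (Bool)
open import Data.List using (length; filter; allFin)
open import Data.Product using (Σ; _×_; ∃)
open import Data.Sum using (_⊎_)
open import Relation.Nullary using (¬_; Dec)
open import Relation.Binary.PropositionalEquality using (_≡_; _≢_)
open import Function.Definitions using (Injective)

record Graph (n : ℕ) : Set₁ where
  field
    Adj   : Fin n → Fin n → Set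
    adj?  : ∀ u v → Dec (Adj u v)
    sym   : ∀ {u v} → Adj u v → Adj v u
    irrefl : ∀ {u} → ¬ Adj u u
open Graph public

degree : ∀ {n} → Graph n → Fin n → ℕ
degree G v = length (filter (adj? G v) (allFin _))

Bipartite : ∀ {n} → Graph n → Set
Bipartite {n} G = Σ (Fin n → Bool) λ f → ∀ u v → Adj G u v → f u ≢ f v

Consecutive : (L : ℕ) → Fin L → Fin L → Set
Consecutive L i j = (suc (toℕ i) ≡ toℕ j) ⊎ ((suc (toℕ i) ≡ L) × (toℕ j ≡ 0))

HasCycle : ∀ {n} → Graph n → ℕ → Set
HasCycle {n} G L =
  (3 ≤ L) × Σ (Fin L → Fin n) λ c →
    Injective _≡_ _≡_ c × (∀ i j → Consecutive L i j → Adj G (c i) (c j))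

Odd : ℕ → Set
Odd L = ∃ λ m → L ≡ suc (2 * m)

{-# OPTIONS --safe #-}
module Submission where

-- A non-bipartite graph has an odd closed walk: otherwise colouring every vertex by the parity
-- of its walks from a fixed vertex of its component would be a proper 2-colouring. Let C be a
-- shortest odd closed walk, of length L. Splitting C at a repeated vertex would give a shorter
-- odd closed walk, so C is an odd cycle. If L > 3, no vertex y has three neighbours on C: they
-- cut C into three arcs, one of them odd of length d with d + 2 < L, and y closes that arc
-- into a shorter odd closed walk. Counting the edges between C and V(G) then gives
-- L n / (2r + 2) ≤ Σ_{v ∈ C} deg v ≤ 2 n, so L ≤ 4r + 4, and L ≤ 4r + 3 as L is odd.

open import Defs hiding (sym)
open import Data.Nat using (ℕ; zero; suc; _+_; _*_; _∸_; _≤_; _<_; _≤?_; _<?_; z≤n; s≤s; parity; >-nonZero)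
open import Data.Nat.Properties
open import Data.Nat.Induction using (<-rec)
open import Data.Fin as Fin using (Fin; toℕ)
open import Data.Fin.Properties using (any?; pigeonhole; toℕ<n; toℕ-injective)
open import Data.Parity using (0ℙ; 1ℙ; _⁻¹)
import Data.Parity as ℙ
open import Data.Parity.Properties using (+-homo-+; *-homo-*; suc-homo-⁻¹; ⁻¹-selfInverse; p+p⁻¹≡1ℙ)
open import Data.Bool using (Bool; false)
import Data.Bool as Bool
open import Data.List using (List; []; _∷_; length; filter; tabulate; allFin)
open import Data.List.Properties using (filter-≐)
open import Data.List.Membership.Propositional using (_∈_)
open import Data.List.Membership.Propositional.Properties using (∈-filter⁺; ∈-filter⁻; ∈-allFin)
open import Data.List.Relation.Unary.Any using (here)
open import Data.Product using (Σ; _×_; _,_; proj₂; ∃; ∃₂; ∃-syntax)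
open import Data.Sum using (_⊎_; inj₁; inj₂; [_,_]′)
open import Function using (_∘_; id)
open import Data.Empty using (⊥)
open import Relation.Nullary using (¬_; Dec; yes; no; does; contradiction)
open import Relation.Nullary.Decidable using (_×-dec_)
open import Relation.Unary using (Pred; Decidable)
open import Relation.Binary using (tri<; tri≈; tri>)
open import Relation.Binary.PropositionalEquality
  using (_≡_; _≢_; refl; sym; trans; cong; cong₂; subst; subst₂; module ≡-Reasoning)
open import Algebra.Properties.CommutativeMonoid.Sum +-0-commutativeMonoid
  using (sum-syntax; ∑-distrib-+; sum-replicate-zero)

odd-+⇒odd⊎odd : ∀ m n → parity (m + n) ≡ 1ℙ → parity m ≡ 1ℙ ⊎ parity n ≡ 1ℙ
odd-+⇒odd⊎odd m n odd = split (parity m) (parity n) (trans (sym (+-homo-+ m n)) odd)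
  where
  split : ∀ p q → p ℙ.+ q ≡ 1ℙ → p ≡ 1ℙ ⊎ q ≡ 1ℙ
  split 1ℙ q _ = inj₁ refl
  split 0ℙ q e = inj₂ e

parity-suc : ∀ n → parity (suc n) ≡ parity n ⁻¹
parity-suc n = sym (⁻¹-selfInverse (suc-homo-⁻¹ n))

sameParity⇒odd-+-suc : ∀ {m n} → parity m ≡ parity n → parity (m + suc n) ≡ 1ℙ
sameParity⇒odd-+-suc {m} {n} same = begin
  parity (m + suc n)              ≡⟨ +-homo-+ m (suc n) ⟩
  parity m ℙ.+ parity (suc n)     ≡⟨ cong₂ ℙ._+_ same (parity-suc n) ⟩
  parity n ℙ.+ parity n ⁻¹        ≡⟨ p+p⁻¹≡1ℙ (parity n) ⟩
  1ℙ                              ∎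
  where open ≡-Reasoning

≢0ℙ⇒≡1ℙ : ∀ {p} → p ≢ 0ℙ → p ≡ 1ℙ
≢0ℙ⇒≡1ℙ {0ℙ} p≢0 = contradiction refl p≢0
≢0ℙ⇒≡1ℙ {1ℙ} _   = refl

parity≡1ℙ⇒Odd : ∀ {n} → parity n ≡ 1ℙ → Odd n
parity≡1ℙ⇒Odd {1}           _   = 0 , refl
parity≡1ℙ⇒Odd {suc (suc n)} odd with parity≡1ℙ⇒Odd {n} odd
... | m , refl = suc m , cong (suc ∘ suc) (sym (+-suc m (m + 0)))

odd∧≢1⇒3≤ : ∀ {n} → parity n ≡ 1ℙ → n ≢ 1 → 3 ≤ n
odd∧≢1⇒3≤ {1}                 _ n≢1 = contradiction refl n≢1
odd∧≢1⇒3≤ {suc (suc (suc _))} _ _   = s≤s (s≤s (s≤s z≤n))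

odd≤2*suc⇒≤2*+1 : ∀ {n} k → parity n ≡ 1ℙ → n ≤ 2 * suc k → n ≤ 2 * k + 1
odd≤2*suc⇒≤2*+1 {n} k odd n≤ with m≤n⇒m<n∨m≡n n≤
... | inj₁ n< = subst (n ≤_) (+-comm 1 (2 * k)) (≤-pred (subst (n <_) (*-suc 2 k) n<))
... | inj₂ refl with () ← trans (sym odd) (*-homo-* 2 (suc k))

Least : ∀ {p} → Pred ℕ p → Pred ℕ p
Least P k = P k × (∀ {j} → j < k → ¬ P j)

least : ∀ {p} {P : Pred ℕ p} → Decidable P → ∀ {m} → P m → ∃ (Least P)
least {P = P} P? {m} = <-rec (λ m → P m → ∃ (Least P)) search m
  where
  search : ∀ m → (∀ {j} → j < m → P j → ∃ (Least P)) → P m → ∃ (Least P)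
  search m smaller Pm with anyUpTo? P? m
  ... | yes (j , j<m , Pj) = smaller j<m Pj
  ... | no none            = m , Pm , λ j<m Pj → none (_ , j<m , Pj)

sumBelow : ℕ → (ℕ → ℕ) → ℕ
sumBelow zero    f = 0
sumBelow (suc L) f = sumBelow L f + f L

*-≤-sumBelow : ∀ {c k} (f : ℕ → ℕ) L → (∀ s → c ≤ k * f s) → L * c ≤ k * sumBelow L f
*-≤-sumBelow f zero    _ = z≤n
*-≤-sumBelow {c} {k} f (suc L) c≤ = begin
  c + L * c                   ≤⟨ +-mono-≤ (c≤ L) (*-≤-sumBelow {c} {k} f L c≤) ⟩
  k * f L + k * sumBelow L f  ≡⟨ +-comm (k * f L) _ ⟩
  k * sumBelow L f + k * f L  ≡⟨ *-distribˡ-+ k (sumBelow L f) (f L) ⟨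
  k * sumBelow (suc L) f      ∎
  where open ≤-Reasoning

∑-≤-* : ∀ {c} n (f : Fin n → ℕ) → (∀ i → f i ≤ c) → ∑[ i < n ] f i ≤ n * c
∑-≤-* zero    f _  = z≤n
∑-≤-* (suc n) f ≤c = +-mono-≤ (≤c _) (∑-≤-* n (f ∘ Fin.suc) (≤c ∘ Fin.suc))

indicator : ∀ {a} {A : Set a} → Dec A → ℕ
indicator (yes _) = 1
indicator (no _)  = 0

count : ∀ {p} {P : Pred ℕ p} → Decidable P → ℕ → ℕ
count P? L = sumBelow L (indicator ∘ P?)

count-witness : ∀ {p} {P : Pred ℕ p} (P? : Decidable P) {m} L →
                suc m ≤ count P? L → ∃[ a ] a < L × P a × m ≤ count P? a
count-witness {P = P} P? {m} (suc L) m< = lastCase (P? L) m<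
  where
  lastCase : (d : Dec (P L)) → suc m ≤ count P? L + indicator d →
             ∃[ a ] a < suc L × P a × m ≤ count P? a
  lastCase (yes PL) m< = L , ≤-refl , PL , ≤-pred (subst (suc m ≤_) (+-comm (count P? L) 1) m<)
  lastCase (no _)   m<
    with a , a<L , Pa , m≤ ← count-witness P? L (subst (suc m ≤_) (+-identityʳ _) m<)
    = a , m<n⇒m<1+n a<L , Pa , m≤

length-filter-tabulate : ∀ {a p} {A : Set a} {P : Pred A p} (P? : Decidable P) {n} (f : Fin n → A) →
                         length (filter P? (tabulate f)) ≡ ∑[ i < n ] indicator (P? (f i))
length-filter-tabulate P? {zero}  f = refl
length-filter-tabulate P? {suc n} f with P? (f Fin.zero)
... | yes _ = cong suc (length-filter-tabulate P? (f ∘ Fin.suc))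
... | no _  = length-filter-tabulate P? (f ∘ Fin.suc)

∸-+-∸ : ∀ {a b c} → a ≤ b → b ≤ c → (b ∸ a) + (c ∸ b) ≡ c ∸ a
∸-+-∸ {a} {b} {c} a≤b b≤c = begin
  (b ∸ a) + (c ∸ b)  ≡⟨ +-comm (b ∸ a) (c ∸ b) ⟩
  (c ∸ b) + (b ∸ a)  ≡⟨ +-∸-assoc (c ∸ b) a≤b ⟨
  (c ∸ b) + b ∸ a    ≡⟨ cong (_∸ a) (m∸n+n≡m b≤c) ⟩
  c ∸ a              ∎
  where open ≡-Reasoning

two-arcs : ∀ {i j L} → i ≤ j → j ≤ L → (j ∸ i) + (L ∸ j + i) ≡ L
two-arcs {i} {j} {L} i≤j j≤L = begin
  (j ∸ i) + (L ∸ j + i)  ≡⟨ cong ((j ∸ i) +_) (+-comm (L ∸ j) i) ⟩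
  (j ∸ i) + (i + (L ∸ j)) ≡⟨ +-assoc (j ∸ i) i (L ∸ j) ⟨
  (j ∸ i) + i + (L ∸ j)   ≡⟨ cong (_+ (L ∸ j)) (m∸n+n≡m i≤j) ⟩
  j + (L ∸ j)             ≡⟨ m+[n∸m]≡n j≤L ⟩
  L                       ∎
  where open ≡-Reasoning

three-arcs : ∀ {a b c L} → a ≤ b → b ≤ c → c ≤ L → (b ∸ a) + (c ∸ b) + (L ∸ c + a) ≡ L
three-arcs {a} {b} {c} {L} a≤b b≤c c≤L =
  trans (cong (_+ (L ∸ c + a)) (∸-+-∸ a≤b b≤c)) (two-arcs (≤-trans a≤b b≤c) c≤L)

ShortOdd : ℕ → ℕ → Set
ShortOdd L d = parity d ≡ 1ℙ × 2 + d < L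

-- If the odd arc d is too long, the two others have total length at most 2, so both are 1.
odd-arc-short : ∀ {d e f L} → parity d ≡ 1ℙ → 1 ≤ e → 1 ≤ f → d + (e + f) ≡ L → 3 < L →
                ShortOdd L d ⊎ ShortOdd L e
odd-arc-short {d} {e} {f} {L} odd 1≤e 1≤f arcs 3<L with 2 + d <? L
... | yes short = inj₁ (odd , short)
... | no long   = inj₂ (subst (ShortOdd L) (sym e≡1) (refl , 3<L))
  where
  e+f≤2 : e + f ≤ 2
  e+f≤2 = +-cancelˡ-≤ d (e + f) 2 (subst₂ _≤_ (sym arcs) (+-comm 2 d) (≮⇒≥ long))
  e≡1 : e ≡ 1
  e≡1 = ≤-antisym (+-cancelʳ-≤ 1 e 1 (≤-trans (+-monoʳ-≤ e 1≤f) e+f≤2)) 1≤e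

odd-short-arc : ∀ {d₁ d₂ d₃ L} → 1 ≤ d₁ → 1 ≤ d₂ → 1 ≤ d₃ → d₁ + d₂ + d₃ ≡ L →
                parity L ≡ 1ℙ → 3 < L → ShortOdd L d₁ ⊎ ShortOdd L d₂ ⊎ ShortOdd L d₃
odd-short-arc {d₁} {d₂} {d₃} 1≤d₁ 1≤d₂ 1≤d₃ arcs odd 3<L
  with odd-+⇒odd⊎odd (d₁ + d₂) d₃ (subst (λ t → parity t ≡ 1ℙ) (sym arcs) odd)
... | inj₂ odd₃ = [ inj₂ ∘ inj₂ , inj₁ ]′
  (odd-arc-short odd₃ 1≤d₁ 1≤d₂ (trans (+-comm d₃ (d₁ + d₂)) arcs) 3<L)
... | inj₁ odd₁₂ with odd-+⇒odd⊎odd d₁ d₂ odd₁₂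
...   | inj₁ odd₁ = [ inj₁ , inj₂ ∘ inj₁ ]′
  (odd-arc-short odd₁ 1≤d₂ 1≤d₃ (trans (sym (+-assoc d₁ d₂ d₃)) arcs) 3<L)
...   | inj₂ odd₂ = [ inj₂ ∘ inj₁ , inj₁ ]′
  (odd-arc-short odd₂ 1≤d₁ 1≤d₃
    (trans (sym (+-assoc d₂ d₁ d₃)) (trans (cong (_+ d₃) (+-comm d₂ d₁)) arcs)) 3<L)

module _ {n : ℕ} (G : Graph n) where

  infixr 5 _∷_ _++_
  infixl 5 _∷ʳ_
  infixl 9 _at_

  data Walk : ℕ → Fin n → Fin n → Set where
    []  : ∀ {u} → Walk 0 u u
    _∷_ : ∀ {t u v w} → Adj G u v → Walk t v w → Walk (suc t) u w

  _++_ : ∀ {s t u v w} → Walk s u v → Walk t v w → Walk (s + t) u w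
  []      ++ W′ = W′
  (a ∷ W) ++ W′ = a ∷ (W ++ W′)

  _∷ʳ_ : ∀ {t u v w} → Walk t u v → Adj G v w → Walk (suc t) u w
  []      ∷ʳ b = b ∷ []
  (a ∷ W) ∷ʳ b = a ∷ (W ∷ʳ b)

  reverse : ∀ {t u v} → Walk t u v → Walk t v u
  reverse []      = []
  reverse (a ∷ W) = reverse W ∷ʳ Graph.sym G a

  detour : ∀ {d u v y} → Adj G u y → Walk d u v → Adj G v y → Walk (2 + d) y y
  detour uy W vy = Graph.sym G uy ∷ (W ∷ʳ vy)

  no-closed-walk-of-length-1 : ∀ {u} → ¬ Walk 1 u u
  no-closed-walk-of-length-1 (a ∷ []) = irrefl G a

  -- Positions beyond the end of the walk are sent to its last vertex.
  _at_ : ∀ {t u v} → Walk t u v → ℕ → Fin n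
  _at_ {u = u} _      zero    = u
  _at_ {v = v} []     (suc s) = v
  (_ ∷ W) at suc s = W at s

  at-end : ∀ {t u v} (W : Walk t u v) → W at t ≡ v
  at-end []      = refl
  at-end (_ ∷ W) = at-end W

  at-adj : ∀ {t u v} (W : Walk t u v) {s} → s < t → Adj G (W at s) (W at suc s)
  at-adj (a ∷ W) {zero}  _         = a
  at-adj (a ∷ W) {suc s} (s≤s s<t) = at-adj W s<t

  segment : ∀ {t u v} (W : Walk t u v) {i j} → i ≤ j → j ≤ t → Walk (j ∸ i) (W at i) (W at j)
  segment W       {zero}  {zero}  _         _         = []
  segment (a ∷ W) {zero}  {suc j} _         (s≤s j≤t) = a ∷ segment W z≤n j≤t
  segment (a ∷ W) {suc i} {suc j} (s≤s i≤j) (s≤s j≤t) = segment W i≤j j≤t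

  walk? : ∀ t u v → Dec (Walk t u v)
  walk? zero    u v with u Fin.≟ v
  ... | yes refl = yes []
  ... | no u≢v   = no λ { [] → u≢v refl }
  walk? (suc t) u v with any? (λ w → adj? G u w ×-dec walk? t w v)
  ... | yes (w , a , W) = yes (a ∷ W)
  ... | no none         = no λ { (a ∷ W) → none (_ , a , W) }

  -- Pigeonhole: some vertex repeats, and the closed subwalk between its two visits is cut out.
  shortcut : ∀ {t u v} (W : Walk t u v) → n ≤ t → ∃[ t′ ] t′ < t × Walk t′ u v
  shortcut {t} W n≤t with i , j , i<j , same ← pigeonhole (s≤s n≤t) (λ k → W at toℕ k) =
    toℕ i + (t ∸ toℕ j) ,
    subst (toℕ i + (t ∸ toℕ j) <_) (m+[n∸m]≡n j≤t) (+-monoˡ-< (t ∸ toℕ j) i<j) ,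
    segment W z≤n i≤t ++ subst₂ (Walk _) (sym same) (at-end W) (segment W j≤t ≤-refl)
    where
    j≤t = ≤-pred (toℕ<n j)
    i≤t = ≤-trans (<⇒≤ i<j) j≤t

  Reach : Fin n → Fin n → Set
  Reach u v = ∃[ t ] t < n × Walk t u v

  reach? : ∀ u v → Dec (Reach u v)
  reach? u v = anyUpTo? (λ t → walk? t u v) n

  walk⇒reach : ∀ {t u v} → Walk t u v → Reach u v
  walk⇒reach {u = u} {v} W with t , W′ , shortest ← least (λ t → walk? t u v) W =
    t , ≰⇒> (λ n≤t → let t′ , t′<t , W″ = shortcut W′ n≤t in shortest t′<t W″) , W′

  reach-∷ʳ : ∀ {u v w} → Reach u v → Adj G v w → Reach u w
  reach-∷ʳ (_ , _ , W) vw = walk⇒reach (W ∷ʳ vw)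

  EvenReach : Fin n → Fin n → Set
  EvenReach u v = ∃[ t ] t < n × parity t ≡ 0ℙ × Walk t u v

  evenReach? : ∀ u v → Dec (EvenReach u v)
  evenReach? u v = anyUpTo? (λ t → (parity t ℙ.≟ 0ℙ) ×-dec walk? t u v) n

  oddWalk : ∀ {u v} → ¬ EvenReach u v → Reach u v → ∃[ t ] parity t ≡ 1ℙ × Walk t u v
  oddWalk ¬even (t , t<n , W) = t , ≢0ℙ⇒≡1ℙ (λ even → ¬even (t , t<n , even , W)) , W

  sameParityWalks : ∀ {u v w} → Reach u v → Reach u w →
                    does (evenReach? u v) ≡ does (evenReach? u w) →
                    ∃₂ λ t₁ t₂ → parity t₁ ≡ parity t₂ × Walk t₁ u v × Walk t₂ u w
  sameParityWalks {u} {v} {w} reach₁ reach₂ same with evenReach? u v | evenReach? u w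
  ... | yes (t₁ , _ , even₁ , W₁) | yes (t₂ , _ , even₂ , W₂) =
    t₁ , t₂ , trans even₁ (sym even₂) , W₁ , W₂
  ... | no ¬even₁ | no ¬even₂ =
    let t₁ , odd₁ , W₁ = oddWalk ¬even₁ reach₁
        t₂ , odd₂ , W₂ = oddWalk ¬even₂ reach₂
    in t₁ , t₂ , trans odd₁ (sym odd₂) , W₁ , W₂
  ... | yes _ | no _  with () ← same
  ... | no _  | yes _ with () ← same

  roots : Fin n → List (Fin n)
  roots v = filter (λ u → reach? u v) (allFin n)

  roots-adjacent : ∀ {v w} → Adj G v w → roots v ≡ roots w
  roots-adjacent vw = filter-≐ (λ u → reach? u _) (λ u → reach? u _)
    ((λ reach → reach-∷ʳ reach vw) , (λ reach → reach-∷ʳ reach (Graph.sym G vw))) (allFin n)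

  -- roots v is never empty (it contains v), and its head is shared by the whole component.
  colourFrom : List (Fin n) → Fin n → Bool
  colourFrom []      v = false
  colourFrom (u ∷ _) v = does (evenReach? u v)

  colour : Fin n → Bool
  colour v = colourFrom (roots v) v

  OddClosedWalk : ℕ → Set
  OddClosedWalk L = parity L ≡ 1ℙ × ∃[ x ] Walk L x x

  oddClosedWalk? : ∀ L → Dec (OddClosedWalk L)
  oddClosedWalk? L = (parity L ℙ.≟ 1ℙ) ×-dec any? (λ x → walk? L x x)

  monochromatic-edge⇒oddClosedWalk : ∀ {v w} → Adj G v w → colour v ≡ colour w → ∃ OddClosedWalk
  monochromatic-edge⇒oddClosedWalk {v} {w} vw same =
    viaFirstRoot (roots v) (λ u∈ → proj₂ (∈-filter⁻ (λ u → reach? u v) {xs = allFin n} u∈))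
      (∈-filter⁺ (λ u → reach? u v) (∈-allFin v) (walk⇒reach []))
      (trans same (cong (λ rs → colourFrom rs w) (sym (roots-adjacent vw))))
    where
    viaFirstRoot : ∀ rs → (∀ {u} → u ∈ rs → Reach u v) → v ∈ rs →
                   colourFrom rs v ≡ colourFrom rs w → ∃ OddClosedWalk
    viaFirstRoot (u ∷ _) reaches _ sameColour
      with t₁ , t₂ , sameParity , W₁ , W₂ ←
        sameParityWalks (reaches (here refl)) (reach-∷ʳ (reaches (here refl)) vw) sameColour
      = t₁ + suc t₂ , sameParity⇒odd-+-suc {t₁} {t₂} sameParity , u , W₁ ++ vw ∷ reverse W₂

  nonBipartite⇒oddClosedWalk : ¬ Bipartite G → ∃ OddClosedWalk
  nonBipartite⇒oddClosedWalk nonBipartite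
    with any? (λ v → any? (λ w → adj? G v w ×-dec (colour v Bool.≟ colour w)))
  ... | yes (v , w , vw , same) = monochromatic-edge⇒oddClosedWalk vw same
  ... | no none = contradiction (colour , λ v w vw same → none (v , w , vw , same)) nonBipartite

  shortestOddClosedWalk : ¬ Bipartite G → ∃ (Least OddClosedWalk)
  shortestOddClosedWalk nonBipartite =
    least oddClosedWalk? (proj₂ (nonBipartite⇒oddClosedWalk nonBipartite))

  degree≡∑ : ∀ v → degree G v ≡ ∑[ y < n ] indicator (adj? G v y)
  degree≡∑ v = length-filter-tabulate (adj? G v) id

  ∑degree≡∑neighbours : (p : ℕ → Fin n) → ∀ L →
                     sumBelow L (degree G ∘ p) ≡ ∑[ y < n ] count (λ s → adj? G (p s) y) L
  ∑degree≡∑neighbours p zero    = sym (sum-replicate-zero n)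
  ∑degree≡∑neighbours p (suc L) = begin
    sumBelow L (degree G ∘ p) + degree G (p L)
      ≡⟨ cong₂ _+_ (∑degree≡∑neighbours p L) (degree≡∑ (p L)) ⟩
    ∑[ y < n ] count (λ s → adj? G (p s) y) L + ∑[ y < n ] indicator (adj? G (p L) y)
      ≡⟨ ∑-distrib-+ (λ y → count (λ s → adj? G (p s) y) L) (λ y → indicator (adj? G (p L) y)) ⟨
    ∑[ y < n ] count (λ s → adj? G (p s) y) (suc L) ∎
    where open ≡-Reasoning

  ≤2-neighbours⇒length≤2* : ∀ {K} (p : ℕ → Fin n) L → 0 < n → (∀ v → n ≤ K * degree G v) →
            (∀ y → count (λ s → adj? G (p s) y) L ≤ 2) → L ≤ 2 * K
  ≤2-neighbours⇒length≤2* {K} p L n>0 δ≥ ≤2 = *-cancelʳ-≤ L (2 * K) n ⦃ >-nonZero n>0 ⦄ (begin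
    L * n                                         ≤⟨ *-≤-sumBelow {n} {K} (degree G ∘ p) L (δ≥ ∘ p) ⟩
    K * sumBelow L (degree G ∘ p)                 ≡⟨ cong (K *_) (∑degree≡∑neighbours p L) ⟩
    K * ∑[ y < n ] count (λ s → adj? G (p s) y) L ≤⟨ *-monoʳ-≤ K (∑-≤-* n _ ≤2) ⟩
    K * (n * 2)                                   ≡⟨ cong (K *_) (*-comm n 2) ⟩
    K * (2 * n)                                   ≡⟨ *-assoc K 2 n ⟨
    K * 2 * n                                     ≡⟨ cong (_* n) (*-comm K 2) ⟩
    2 * K * n                                     ∎)
    where open ≤-Reasoning

  module ShortestOddClosedWalk {L x} (W : Walk L x x) (odd : parity L ≡ 1ℙ)
                               (shortest : ∀ {L′} → L′ < L → ¬ OddClosedWalk L′) where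

    shorter : ∀ {t y} → t < L → parity t ≡ 1ℙ → ¬ Walk t y y
    shorter t<L odd′ W′ = shortest t<L (odd′ , _ , W′)

    wrap : ∀ {i j} → i ≤ L → j ≤ L → Walk (L ∸ j + i) (W at j) (W at i)
    wrap i≤L j≤L = subst (Walk _ _) (at-end W) (segment W j≤L ≤-refl) ++ segment W z≤n i≤L

    -- Both closed walks obtained by splitting at a repeated vertex are shorter, and one is odd.
    no-repeat : ∀ {i j} → i < j → j < L → W at i ≢ W at j
    no-repeat {i} {j} i<j j<L same
      with odd-+⇒odd⊎odd (j ∸ i) (L ∸ j + i)
             (subst (λ t → parity t ≡ 1ℙ) (sym (two-arcs (<⇒≤ i<j) (<⇒≤ j<L))) odd)
    ... | inj₁ odd-inner = shorter (≤-<-trans (m∸n≤m j i) j<L) odd-inner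
      (subst (Walk _ _) (sym same) (segment W (<⇒≤ i<j) (<⇒≤ j<L)))
    ... | inj₂ odd-outer = shorter
      (subst (L ∸ j + i <_) (m∸n+n≡m (<⇒≤ j<L)) (+-monoʳ-< (L ∸ j) i<j)) odd-outer
      (subst (Walk _ _) same (wrap (<⇒≤ (<-trans i<j j<L)) (<⇒≤ j<L)))

    at-injective : ∀ {i j} → i < L → j < L → W at i ≡ W at j → i ≡ j
    at-injective {i} {j} i<L j<L same with <-cmp i j
    ... | tri< i<j _ _ = contradiction same (no-repeat i<j j<L)
    ... | tri≈ _ i≡j _ = i≡j
    ... | tri> _ _ j<i = contradiction (sym same) (no-repeat j<i i<L)

    cycle : HasCycle G L
    cycle = odd∧≢1⇒3≤ odd (λ L≡1 → no-closed-walk-of-length-1 (subst (λ t → Walk t x x) L≡1 W)) ,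
            (λ i → W at toℕ i) ,
            (λ same → toℕ-injective (at-injective (toℕ<n _) (toℕ<n _) same)) ,
            consecutive
      where
      consecutive : ∀ i j → Consecutive L i j → Adj G (W at toℕ i) (W at toℕ j)
      consecutive i j (inj₁ next) = subst (λ k → Adj G (W at toℕ i) (W at k)) next (at-adj W (toℕ<n i))
      consecutive i j (inj₂ (last , first)) =
        subst (Adj G (W at toℕ i)) (trans (cong (W at_) last) (trans (at-end W) (cong (W at_) (sym first))))
          (at-adj W (toℕ<n i))

    three-neighbours : ∀ {a b c y} → 3 < L → a < b → b < c → c < L →
                       Adj G (W at a) y → Adj G (W at b) y → Adj G (W at c) y → ⊥
    three-neighbours {a} {b} {c} 3<L a<b b<c c<L ay by cy =
      [ shorterDetour ay (segment W (<⇒≤ a<b) (<⇒≤ b<L)) by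
      , [ shorterDetour by (segment W (<⇒≤ b<c) (<⇒≤ c<L)) cy
        , shorterDetour cy (wrap (<⇒≤ a<L) (<⇒≤ c<L)) ay ]′ ]′
      (odd-short-arc (m<n⇒0<n∸m a<b) (m<n⇒0<n∸m b<c) (≤-trans (m<n⇒0<n∸m c<L) (m≤m+n (L ∸ c) a))
        (three-arcs (<⇒≤ a<b) (<⇒≤ b<c) (<⇒≤ c<L)) odd 3<L)
      where
      b<L = <-trans b<c c<L
      a<L = <-trans a<b b<L
      shorterDetour : ∀ {d u v y} → Adj G u y → Walk d u v → Adj G v y → ShortOdd L d → ⊥
      shorterDetour uy arc vy (odd-arc , short) = shorter short odd-arc (detour uy arc vy)

    at-most-two-neighbours : 3 < L → ∀ y → count (λ s → adj? G (W at s) y) L ≤ 2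
    at-most-two-neighbours 3<L y = ≮⇒≥ λ 3≤count →
      let c , c<L , cy , 2≤count = count-witness (λ s → adj? G (W at s) y) L 3≤count
          b , b<c , by , 1≤count = count-witness (λ s → adj? G (W at s) y) c 2≤count
          a , a<b , ay , _       = count-witness (λ s → adj? G (W at s) y) b 1≤count
      in three-neighbours 3<L a<b b<c c<L ay by cy

    length≤2*+1 : ∀ {K} → 1 ≤ K → (∀ v → n ≤ suc K * degree G v) → L ≤ 2 * K + 1
    length≤2*+1 {K} 1≤K δ≥ with L ≤? 3
    ... | yes L≤3 = ≤-trans L≤3 (+-monoˡ-≤ 1 (*-monoʳ-≤ 2 1≤K))
    ... | no 3<L  = odd≤2*suc⇒≤2*+1 K odd
      (≤2-neighbours⇒length≤2* (W at_) L (≤-<-trans z≤n (toℕ<n x)) δ≥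
        (at-most-two-neighbours (≰⇒> 3<L)))

lemma3p5 : (r k n : ℕ) → 2 ≤ r → 1 ≤ k → 1 ≤ n → (G : Graph n) →
           ¬ Bipartite G →
           ¬ HasCycle G (2 * k + 1) →
           (∀ v → n ≤ (2 * r + 2) * degree G v) →
           Σ ℕ λ L → Odd L × L ≤ 2 * (2 * r + 1) + 1 × HasCycle G L
lemma3p5 r k n _ _ _ G nonBipartite _ δ≥
  with L , (odd , x , W) , shortest ← shortestOddClosedWalk G nonBipartite =
  L , parity≡1ℙ⇒Odd odd , length≤2*+1 (m≤n+m 1 (2 * r)) δ≥′ , cycle
  where
  open ShortestOddClosedWalk G W odd shortest
  δ≥′ : ∀ v → n ≤ suc (2 * r + 1) * degree G v
  δ≥′ v = subst (λ K → n ≤ K * degree G v) (+-suc (2 * r) 1) (δ≥ v)
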